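{- Let $f,h\in F(n)$ and suppose that $\mathcal{A}(f)$ and $\mathcal{A}(h)$ are isometric. Then $f\sim h$.
   Context: $F(n)$ is the set of all functions $f:\{0,1\}^n\to\{0,1\}^n$, written $f=(f_1,\dots,f_n)$. $e_i$ is the configuration with a $1$ exactly in component $i$; addition is componentwise modulo $2$. The asynchronous graph $\mathcal{A}(f)$ is the digraph on $\{0,1\}^n$ with an arc from $x$ to $x+e_i$ whenever $f_i(x)\neq x_i$. $Q_n$ is the $n$-cube (graph on $\{0,1\}^n$, $x,y$ adjacent iff they differ in exactly one component). An isometry is an automorphism of $Q_n$. Two digraphs on $\{0,1\}^n$ are isometric if there exists a digraph isomorphism between them which is an isometry. $\mathcal{S}(f)$ has an arc $x\to f(x)$; $f\sim h$ means $\mathcal{S}(f)$ and $\mathcal{S}(h)$ are isomorphic. -}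

module Defs where

open import Data.Nat using (ℕ)
open import Data.Bool using (Bool; not)
open import Data.Fin using (Fin)
open import Data.Vec using (Vec; lookup; updateAt)
open import Data.Product using (∃; _×_)
open import Relation.Binary.PropositionalEquality using (_≡_; _≢_)
open import Function.Bundles using (Bijection; _⤖_; _⇔_)

Config : ℕ → Set
Config n = Vec Bool n

-- F(n) : all functions {0,1}^n → {0,1}^n ; f_i(x) = lookup (f x) i
F : ℕ → Set
F n = Config n → Config n

flip : ∀ {n} → Config n → Fin n → Config n
flip x i = updateAt x i not

Adj : ∀ {n} → Config n → Config n → Set
Adj x y = ∃ λ i → y ≡ flip x i

AArc : ∀ {n} → F n → Config n → Config n → Set
AArc f x y = ∃ λ i → (lookup (f x) i ≢ lookup x i) × (y ≡ flip x i)

-- an isometry: an automorphism of Q_n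
IsIsometry : ∀ {n} → Config n ⤖ Config n → Set
IsIsometry {n} σ = ∀ (x y : Config n) → Adj x y ⇔ Adj (Bijection.to σ x) (Bijection.to σ y)

AIsometric : ∀ {n} → F n → F n → Set
AIsometric {n} f h = ∃ λ (σ : Config n ⤖ Config n) →
  IsIsometry σ × (∀ (x y : Config n) → AArc f x y ⇔ AArc h (Bijection.to σ x) (Bijection.to σ y))

SArc : ∀ {n} → F n → Config n → Config n → Set
SArc f x y = f x ≡ y

_∼_ : ∀ {n} → F n → F n → Set
_∼_ {n} f h = ∃ λ (φ : Config n ⤖ Config n) →
  ∀ (x y : Config n) → SArc f x y ⇔ SArc h (Bijection.to φ x) (Bijection.to φ y)

{-# OPTIONS --safe #-}
module Submission where

-- An automorphism σ of Q_n preserves Hamming distance: σ and σ⁻¹ map geodesics to walks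
-- of the same length. In A(f) the arc x → x + e_i is present iff x + e_i is strictly
-- closer to f(x) than x is, and a configuration is determined by which neighbours of x
-- are closer to it than x. As σ maps the neighbours of x onto those of σ(x) and the arcs
-- of A(f) onto those of A(h), h(σ(x)) and σ(f(x)) have the same closer neighbours of
-- σ(x); hence h ∘ σ = σ ∘ f, and σ itself is an isomorphism from S(f) to S(h).

open import Data.Nat using (ℕ; suc; _+_; _≤_; _<_; s≤s)
open import Data.Nat.Properties
  using (≤-reflexive; ≤-trans; ≤-antisym; m≤n⇒m≤1+n; n≤1+n; <⇒≱; +-suc; module ≤-Reasoning)
open import Data.Bool using (Bool; true; false; _xor_; if_then_else_)
open import Data.Bool.Properties using (_≟_)
open import Data.Fin using (zero; suc)
open import Data.Vec using ([]; _∷_; lookup; tabulate)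
open import Data.Vec.Properties using (tabulate∘lookup; tabulate-cong)
open import Data.Product using (_,_)
open import Relation.Nullary using (yes; no; contradiction)
open import Relation.Binary.Core using (_Preserves_⟶_)
open import Relation.Binary.PropositionalEquality
open import Function.Bundles using (Bijection; Inverse; _⤖_; _⇔_; mk⇔; Equivalence)
open import Function.Properties.Bijection using (⤖⇒↔)
open import Function.Properties.Equivalence using () renaming (sym to ⇔-sym; trans to ⇔-trans)
open import Function.Related.Propositional using (module EquationalReasoning)
open import Defs

private
  variable
    m n k : ℕ
    x y z : Config n

hamming : Config n → Config n → ℕ
hamming []      []      = 0
hamming (a ∷ x) (b ∷ z) = (if a xor b then 1 else 0) + hamming x z

_closer-to_than_ : Config n → Config n → Config n → Set
y closer-to z than x = hamming y z < hamming x z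

hamming-self : ∀ (x : Config n) → hamming x x ≡ 0
hamming-self []          = refl
hamming-self (false ∷ x) = hamming-self x
hamming-self (true  ∷ x) = hamming-self x

hamming-flip-disagreeing : ∀ (x z : Config n) i →
  lookup z i ≢ lookup x i → suc (hamming (flip x i) z) ≡ hamming x z
hamming-flip-disagreeing (false ∷ x) (false ∷ z) zero    ne = contradiction refl ne
hamming-flip-disagreeing (true  ∷ x) (true  ∷ z) zero    ne = contradiction refl ne
hamming-flip-disagreeing (false ∷ x) (true  ∷ z) zero    ne = refl
hamming-flip-disagreeing (true  ∷ x) (false ∷ z) zero    ne = refl
hamming-flip-disagreeing (a ∷ x)     (b ∷ z)     (suc i) ne =
  trans (sym (+-suc _ _)) (cong (_ +_) (hamming-flip-disagreeing x z i ne))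

hamming-flip-agreeing : ∀ (x z : Config n) i →
  lookup z i ≡ lookup x i → hamming (flip x i) z ≡ suc (hamming x z)
hamming-flip-agreeing (false ∷ x) (false ∷ z) zero    eq = refl
hamming-flip-agreeing (true  ∷ x) (true  ∷ z) zero    eq = refl
hamming-flip-agreeing (a ∷ x)     (b ∷ z)     (suc i) eq =
  trans (cong (_ +_) (hamming-flip-agreeing x z i eq)) (+-suc _ _)

flip-closer⇔disagreeing : ∀ (x z : Config n) i →
  flip x i closer-to z than x ⇔ lookup z i ≢ lookup x i
flip-closer⇔disagreeing x z i = mk⇔
  (λ closer eq → <⇒≱ closer (≤-trans (n≤1+n _) (≤-reflexive (sym (hamming-flip-agreeing x z i eq)))))
  (λ ne → ≤-reflexive (hamming-flip-disagreeing x z i ne))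

hamming-≤-suc-neighbour : Adj x y → hamming x z ≤ suc (hamming y z)
hamming-≤-suc-neighbour {x = x} {z = z} (i , refl) with lookup z i ≟ lookup x i
... | yes eq = m≤n⇒m≤1+n (≤-trans (n≤1+n _) (≤-reflexive (sym (hamming-flip-agreeing x z i eq))))
... | no ne  = ≤-reflexive (sym (hamming-flip-disagreeing x z i ne))

data Walk {n} : ℕ → Config n → Config n → Set where
  []  : Walk 0 x x
  _∷_ : Adj x y → Walk k y z → Walk (suc k) x z

map-walk : (g : Config m → Config n) → g Preserves Adj ⟶ Adj → Walk k x z → Walk k (g x) (g z)
map-walk g g-adj []        = []
map-walk g g-adj (adj ∷ w) = g-adj adj ∷ map-walk g g-adj w

hamming-≤-length : Walk k x z → hamming x z ≤ k
hamming-≤-length {x = x} [] = ≤-reflexive (hamming-self x)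
hamming-≤-length (adj ∷ w)  = ≤-trans (hamming-≤-suc-neighbour adj) (s≤s (hamming-≤-length w))

∷-preserves-Adj : ∀ (b : Bool) → (b ∷_) Preserves Adj {n} ⟶ Adj
∷-preserves-Adj b (i , refl) = suc i , refl

geodesic : ∀ (x z : Config n) → Walk (hamming x z) x z
geodesic []          []          = []
geodesic (false ∷ x) (false ∷ z) = map-walk (false ∷_) (∷-preserves-Adj false) (geodesic x z)
geodesic (true  ∷ x) (true  ∷ z) = map-walk (true ∷_) (∷-preserves-Adj true) (geodesic x z)
geodesic (false ∷ x) (true  ∷ z) =
  (zero , refl) ∷ map-walk (true ∷_) (∷-preserves-Adj true) (geodesic x z)
geodesic (true  ∷ x) (false ∷ z) =
  (zero , refl) ∷ map-walk (false ∷_) (∷-preserves-Adj false) (geodesic x z)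

hamming-nonexpanding : ∀ (g : Config m → Config n) → g Preserves Adj ⟶ Adj →
  ∀ x z → hamming (g x) (g z) ≤ hamming x z
hamming-nonexpanding g g-adj x z = hamming-≤-length (map-walk g g-adj (geodesic x z))

≢-cong⇒≡ : ∀ {a b c : Bool} → (a ≢ c ⇔ b ≢ c) → a ≡ b
≢-cong⇒≡ {false} {false}         _  = refl
≢-cong⇒≡ {true}  {true}          _  = refl
≢-cong⇒≡ {false} {true}  {false} ≢⇔ = contradiction refl (Equivalence.from ≢⇔ (λ ()))
≢-cong⇒≡ {false} {true}  {true}  ≢⇔ = contradiction refl (Equivalence.to ≢⇔ (λ ()))
≢-cong⇒≡ {true}  {false} {false} ≢⇔ = contradiction refl (Equivalence.to ≢⇔ (λ ()))
≢-cong⇒≡ {true}  {false} {true}  ≢⇔ = contradiction refl (Equivalence.from ≢⇔ (λ ()))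

closer-neighbours-determine-target : ∀ {x z z′ : Config n} →
  (∀ {y} → Adj x y → y closer-to z than x ⇔ y closer-to z′ than x) → z ≡ z′
closer-neighbours-determine-target {x = x} {z} {z′} same = begin
  z                    ≡⟨ tabulate∘lookup z ⟨
  tabulate (lookup z)  ≡⟨ tabulate-cong coordinate ⟩
  tabulate (lookup z′) ≡⟨ tabulate∘lookup z′ ⟩
  z′                   ∎
  where
  open ≡-Reasoning
  coordinate : ∀ i → lookup z i ≡ lookup z′ i
  coordinate i = ≢-cong⇒≡ (⇔-trans (⇔-sym (flip-closer⇔disagreeing x z i))
                          (⇔-trans (same (i , refl)) (flip-closer⇔disagreeing x z′ i)))

arc⇔closer : ∀ (f : F n) → Adj x y → AArc f x y ⇔ y closer-to f x than x
arc⇔closer {x = x} f (i , refl) = mk⇔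
  (λ { (j , ne , y≡flip) → subst (_closer-to f x than x) (sym y≡flip)
                                 (Equivalence.from (flip-closer⇔disagreeing x (f x) j) ne) })
  (λ closer → i , Equivalence.to (flip-closer⇔disagreeing x (f x) i) closer , refl)

conjugate⇒∼ : ∀ (f h : F n) (φ : Config n ⤖ Config n) →
  (∀ x → h (Bijection.to φ x) ≡ Bijection.to φ (f x)) → f ∼ h
conjugate⇒∼ f h φ conj = φ , λ x y → mk⇔
  (λ fx≡y → trans (conj x) (cong (Bijection.to φ) fx≡y))
  (λ hφx≡φy → Bijection.injective φ (trans (sym (conj x)) hφx≡φy))

module Isometry (σ : Config n ⤖ Config n) (isometry : IsIsometry σ) where
  open Inverse (⤖⇒↔ σ) using (to; from; strictlyInverseˡ; strictlyInverseʳ)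

  to-preserves-Adj : to Preserves Adj ⟶ Adj
  to-preserves-Adj {x} {y} = Equivalence.to (isometry x y)

  from-preserves-Adj : from Preserves Adj ⟶ Adj
  from-preserves-Adj {x} {y} adj = Equivalence.from (isometry (from x) (from y))
    (subst₂ Adj (sym (strictlyInverseˡ x)) (sym (strictlyInverseˡ y)) adj)

  hamming-preserved : ∀ x z → hamming (to x) (to z) ≡ hamming x z
  hamming-preserved x z = ≤-antisym (hamming-nonexpanding to to-preserves-Adj x z) (begin
    hamming x z                         ≡⟨ cong₂ hamming (strictlyInverseʳ x) (strictlyInverseʳ z) ⟨
    hamming (from (to x)) (from (to z)) ≤⟨ hamming-nonexpanding from from-preserves-Adj (to x) (to z) ⟩
    hamming (to x) (to z)               ∎)
    where open ≤-Reasoning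

  closer-preserved : ∀ x y z → to y closer-to to z than to x ⇔ y closer-to z than x
  closer-preserved x y z = mk⇔
    (subst₂ _<_ (hamming-preserved y z) (hamming-preserved x z))
    (subst₂ _<_ (sym (hamming-preserved y z)) (sym (hamming-preserved x z)))

  neighbours-of-image : ∀ (P : Config n → Set) →
    (∀ {y} → Adj x y → P (to y)) → ∀ {y′} → Adj (to x) y′ → P y′
  neighbours-of-image {x = x} P P-image {y′} adj = subst P (strictlyInverseˡ y′)
    (P-image (subst (λ u → Adj u (from y′)) (strictlyInverseʳ x) (from-preserves-Adj adj)))

  arcs-conjugate⇒conjugate : ∀ (f h : F n) →
    (∀ x y → AArc f x y ⇔ AArc h (to x) (to y)) → ∀ x → h (to x) ≡ to (f x)
  arcs-conjugate⇒conjugate f h arcs x = closer-neighbours-determine-target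
    (neighbours-of-image (λ y′ → y′ closer-to h (to x) than to x ⇔ y′ closer-to to (f x) than to x)
                         same-closer)
    where
    open EquationalReasoning
    same-closer : Adj x y → to y closer-to h (to x) than to x ⇔ to y closer-to to (f x) than to x
    same-closer {y} adj = begin
      to y closer-to h (to x) than to x  ∼⟨ ⇔-sym (arc⇔closer h (to-preserves-Adj adj)) ⟩
      AArc h (to x) (to y)               ∼⟨ ⇔-sym (arcs x y) ⟩
      AArc f x y                         ∼⟨ arc⇔closer f adj ⟩
      y closer-to f x than x             ∼⟨ ⇔-sym (closer-preserved x y (f x)) ⟩
      to y closer-to to (f x) than to x  ∎

lemma1 : ∀ (n : ℕ) (f h : F n) → AIsometric f h → f ∼ h
lemma1 n f h (σ , isometry , arcs) =
  conjugate⇒∼ f h σ (Isometry.arcs-conjugate⇒conjugate σ isometry f h arcs)
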